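{- Let $c\ge1$ be a constant and consider instances of $P|\textit{partition},1\le p_j\le c|\sum_j C_j$. The Shrinking algorithm produces a feasible schedule whose total completion time is at most $c$ times the optimal total completion time; i.e. it is a $c$-approximation algorithm.
   Context: An instance of $P|\textit{partition}|\sum_j C_j$ consists of $m\ge 1$ identical parallel machines, a finite set $J$ of jobs with processing times $p_j>0$, and a partition $R$ of $J$ into classes called resources; two jobs in the same class share a resource. A schedule assigns to each job $j$ one machine and a start time $S_j\ge0$; $j$ is processed without interruption on that machine during $[S_j,C_j)$ with $C_j=S_j+p_j$. It is feasible if the processing intervals of distinct jobs on the same machine are disjoint and the processing intervals of distinct jobs sharing a resource are disjoint; the objective is to minimize $\sum_j C_j$. In $P|\textit{partition},1\le p_j\le c|\sum_j C_j$ all processing times satisfy $1\le p_j\le c$. The Shrinking algorithm: form the instance with the same machines, jobs and partition but all processing times set to $1$; compute an optimal schedule for this unit-time instance in which every job $j$ starts at a nonnegative integer time $s_j$; then output the schedule for the original instance in which each job $j$ is placed on the same machine as in the unit-time schedule and started at time $c\,s_j$.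
   Formalization: The constant $c$, the processing times $p_j$ and the start times $S_j$ of all schedules, including those the bound is compared against, are rational. -}

module Defs where

open import Data.Nat as ℕ using (ℕ; NonZero)
open import Data.Fin using (Fin; zero; suc)
open import Data.Integer using (+_; +<+)
open import Data.Rational using (ℚ; 0ℚ; 1ℚ; _+_; _*_; _≤_; _/_)
open import Data.Sum using (_⊎_)
open import Data.Product using (_×_)
open import Relation.Binary.PropositionalEquality using (_≡_; _≢_)

ℕtoℚ : ℕ → ℚ
ℕtoℚ k = + k / 1

sumFin : (n : ℕ) → (Fin n → ℚ) → ℚ
sumFin ℕ.zero    f = 0ℚ
sumFin (ℕ.suc n) f = f zero + sumFin n (λ i → f (suc i))

-- An instance of P|partition|ΣC_j: m machines, jobs Fin n,
-- processing times p, and a partition of the jobs given by a labelling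
-- (two jobs share a resource iff they carry the same label).
record Instance : Set where
  field
    m    : ℕ
    m≥1  : 1 ℕ.≤ m
    n    : ℕ
    p    : Fin n → ℚ
    p>0  : (j : Fin n) → 0ℚ Data.Rational.< p j
    res  : Fin n → ℕ

record Schedule (I : Instance) : Set where
  field
    mach  : Fin (Instance.n I) → Fin (Instance.m I)
    start : Fin (Instance.n I) → ℚ

completion : (I : Instance) → Schedule I → Fin (Instance.n I) → ℚ
completion I σ j = Schedule.start σ j + Instance.p I j

Feasible : (I : Instance) → Schedule I → Set
Feasible I σ =
  ((j : Fin (Instance.n I)) → 0ℚ ≤ Schedule.start σ j) ×
  ((i j : Fin (Instance.n I)) → i ≢ j →
     (Schedule.mach σ i ≡ Schedule.mach σ j ⊎ Instance.res I i ≡ Instance.res I j) →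
     (completion I σ i ≤ Schedule.start σ j ⊎ completion I σ j ≤ Schedule.start σ i))

totalCompletion : (I : Instance) → Schedule I → ℚ
totalCompletion I σ = sumFin (Instance.n I) (completion I σ)

Optimal : (I : Instance) → Schedule I → Set
Optimal I σ = Feasible I σ × ((τ : Schedule I) → Feasible I τ → totalCompletion I σ ≤ totalCompletion I τ)

BoundedBy : Instance → ℚ → Set
BoundedBy I c = (j : Fin (Instance.n I)) → (1ℚ ≤ Instance.p I j) × (Instance.p I j ≤ c)

unitInstance : Instance → Instance
unitInstance I = record
  { m = Instance.m I ; m≥1 = Instance.m≥1 I ; n = Instance.n I
  ; p = λ _ → 1ℚ ; p>0 = λ _ → Data.Rational.*<* (+<+ (ℕ.s≤s ℕ.z≤n)) ; res = Instance.res I }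

integralSchedule : (I : Instance) → (Fin (Instance.n I) → Fin (Instance.m I)) →
                   (Fin (Instance.n I) → ℕ) → Schedule I
integralSchedule I μ s = record { mach = μ ; start = λ j → ℕtoℚ (s j) }

shrink : (I : Instance) → ℚ → (Fin (Instance.n I) → Fin (Instance.m I)) →
         (Fin (Instance.n I) → ℕ) → Schedule I
shrink I c μ s = record { mach = μ ; start = λ j → c * ℕtoℚ (s j) }

module Submission where

-- Write I₁ for the unit-time instance of I, ρ for the optimal integral unit
-- schedule (machines μ, starts s) and ρ_c for its stretch by the factor c.
--
-- Since p_j ≥ 1, every feasible schedule σ of I, read with
--    unit processing times, is feasible for I₁ and not more expensive; hence
--    cost(ρ) is a lower bound for the cost of every feasible schedule of I.
--  * Stretching.  Since p_j ≤ c, the job j started at c·s_j ends by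
--    c·(s_j + 1): each unit slot of ρ becomes a slot of length c containing
--    the whole job.  So ρ_c inherits feasibility from ρ, and each completion
--    time of ρ_c is at most c times the corresponding one of ρ.
--
-- Chaining:  cost(ρ_c) ≤ c·cost(ρ) ≤ c·cost(σ).

open import Defs
open import Data.Nat using (ℕ)
open import Data.Fin using (Fin; zero; suc)
open import Data.Rational using (ℚ; 0ℚ; 1ℚ; _≤_; _*_; _+_; nonNegative)
open import Data.Rational.Properties
open import Data.Product using (_×_; _,_; proj₁; proj₂)
import Data.Sum as Sum
open import Relation.Binary.PropositionalEquality using (_≡_; cong; subst; sym; module ≡-Reasoning)

sumFin-mono : (n : ℕ) (f g : Fin n → ℚ) → ((j : Fin n) → f j ≤ g j) →
              sumFin n f ≤ sumFin n g
sumFin-mono ℕ.zero    f g f≤g = ≤-refl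
sumFin-mono (ℕ.suc n) f g f≤g =
  +-mono-≤ (f≤g zero) (sumFin-mono n (λ i → f (suc i)) (λ i → g (suc i)) (λ i → f≤g (suc i)))

sumFin-scale : (c : ℚ) (n : ℕ) (f : Fin n → ℚ) →
               sumFin n (λ j → c * f j) ≡ c * sumFin n f
sumFin-scale c ℕ.zero    f = sym (*-zeroʳ c)
sumFin-scale c (ℕ.suc n) f = begin
  c * f zero + sumFin n (λ i → c * f (suc i)) ≡⟨ cong (c * f zero +_) (sumFin-scale c n (λ i → f (suc i))) ⟩
  c * f zero + c * sumFin n (λ i → f (suc i)) ≡⟨ sym (*-distribˡ-+ c (f zero) _) ⟩
  c * (f zero + sumFin n (λ i → f (suc i)))   ∎
  where open ≡-Reasoning

scale-mono : ∀ {c a b} → 0ℚ ≤ c → a ≤ b → c * a ≤ c * b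
scale-mono {c} 0≤c = *-monoˡ-≤-nonNeg c {{nonNegative 0≤c}}

-- A job of length p ≤ c started at c·a is finished by c·(a + 1): the unit
-- slot [a, a+1) stretched by c has room for the whole job.
stretched-slot : ∀ {c} a p → p ≤ c → c * a + p ≤ c * (a + 1ℚ)
stretched-slot {c} a p p≤c = begin
  c * a + p       ≤⟨ +-monoʳ-≤ (c * a) p≤c ⟩
  c * a + c       ≡⟨ cong (c * a +_) (sym (*-identityʳ c)) ⟩
  c * a + c * 1ℚ  ≡⟨ sym (*-distribˡ-+ c a 1ℚ) ⟩
  c * (a + 1ℚ)    ∎
  where open ≤-Reasoning

module _ (I : Instance) where
  open Instance I using (n; p)

  asUnit : Schedule I → Schedule (unitInstance I)
  asUnit σ = record { mach = Schedule.mach σ ; start = Schedule.start σ }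

  module _ (p≥1 : (j : Fin n) → 1ℚ ≤ p j) where

    relax-feasible : (σ : Schedule I) → Feasible I σ → Feasible (unitInstance I) (asUnit σ)
    relax-feasible σ (starts≥0 , disjoint) =
      starts≥0 , λ i j i≢j conflict → Sum.map (shorten i j) (shorten j i) (disjoint i j i≢j conflict)
      where
      S = Schedule.start σ
      shorten : ∀ i j → S i + p i ≤ S j → S i + 1ℚ ≤ S j
      shorten i j = ≤-trans (+-monoʳ-≤ (S i) (p≥1 i))

    relax-cost : (σ : Schedule I) → totalCompletion (unitInstance I) (asUnit σ) ≤ totalCompletion I σ
    relax-cost σ = sumFin-mono n _ _ (λ j → +-monoʳ-≤ (Schedule.start σ j) (p≥1 j))

    unit-optimum-lower-bound : (ρ : Schedule (unitInstance I)) → Optimal (unitInstance I) ρ →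
      (σ : Schedule I) → Feasible I σ → totalCompletion (unitInstance I) ρ ≤ totalCompletion I σ
    unit-optimum-lower-bound ρ (_ , ρ-optimal) σ σ-feasible =
      ≤-trans (ρ-optimal (asUnit σ) (relax-feasible σ σ-feasible)) (relax-cost σ)

  module _ {c : ℚ} (0≤c : 0ℚ ≤ c) (p≤c : (j : Fin n) → p j ≤ c)
           (μ : Fin n → Fin (Instance.m I)) (s : Fin n → ℕ) where

    stretched-completion : (j : Fin n) → completion I (shrink I c μ s) j ≤ c * (ℕtoℚ (s j) + 1ℚ)
    stretched-completion j = stretched-slot (ℕtoℚ (s j)) (p j) (p≤c j)

    shrink-feasible : Feasible (unitInstance I) (integralSchedule (unitInstance I) μ s) →
                      Feasible I (shrink I c μ s)
    shrink-feasible (starts≥0 , disjoint) =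
      stretched-starts≥0 , λ i j i≢j conflict → Sum.map (stretch i j) (stretch j i) (disjoint i j i≢j conflict)
      where
      stretched-starts≥0 : (j : Fin n) → 0ℚ ≤ c * ℕtoℚ (s j)
      stretched-starts≥0 j = subst (_≤ c * ℕtoℚ (s j)) (*-zeroʳ c) (scale-mono 0≤c (starts≥0 j))
      stretch : ∀ i j → ℕtoℚ (s i) + 1ℚ ≤ ℕtoℚ (s j) → completion I (shrink I c μ s) i ≤ c * ℕtoℚ (s j)
      stretch i j unit-before = ≤-trans (stretched-completion i) (scale-mono 0≤c unit-before)

    shrink-cost : totalCompletion I (shrink I c μ s) ≤
                  c * totalCompletion (unitInstance I) (integralSchedule (unitInstance I) μ s)
    shrink-cost = subst (totalCompletion I (shrink I c μ s) ≤_)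
      (sumFin-scale c n (completion (unitInstance I) (integralSchedule (unitInstance I) μ s)))
      (sumFin-mono n _ _ stretched-completion)

mainTheorem6 : (c : ℚ) → 1ℚ ≤ c → (I : Instance) → BoundedBy I c →
    (μ : Fin (Instance.n I) → Fin (Instance.m I)) → (s : Fin (Instance.n I) → ℕ) →
    Optimal (unitInstance I) (integralSchedule (unitInstance I) μ s) →
    Feasible I (shrink I c μ s) ×
    ((σ : Schedule I) → Feasible I σ →
      totalCompletion I (shrink I c μ s) ≤ c * totalCompletion I σ)
mainTheorem6 c 1≤c I bounds μ s ρ-optimal =
  shrink-feasible I 0≤c p≤c μ s (proj₁ ρ-optimal) , approximation
  where
  0≤c : 0ℚ ≤ c
  0≤c = ≤-trans (nonNegative⁻¹ 1ℚ) 1≤c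
  p≤c : (j : Fin (Instance.n I)) → Instance.p I j ≤ c
  p≤c j = proj₂ (bounds j)
  approximation : (σ : Schedule I) → Feasible I σ →
                  totalCompletion I (shrink I c μ s) ≤ c * totalCompletion I σ
  approximation σ σ-feasible =
    ≤-trans (shrink-cost I 0≤c p≤c μ s)
            (scale-mono 0≤c (unit-optimum-lower-bound I (λ j → proj₁ (bounds j)) _ ρ-optimal σ σ-feasible))
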